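{- Let $n\ge3$. A braid-type arrangement $\mathcal{A}\subseteq\mathbb{R}^n$ is both symmetric and strongly transitive if and only if $\mathcal{A}=\mathcal{A}_S^n$ for some set $S\subseteq\mathbb{Z}$ satisfying $S=-S$ and: for all $s,t\in\mathbb{N}\setminus S$, $s+t\notin S$.
   Context: $\mathbb{N}=\{0,1,\dots\}$. For distinct $i,j\in[n]$ and $s\in\mathbb{Z}$, $\{x_i-x_j=s\}=\{x\in\mathbb{R}^n:x_i-x_j=s\}$ (equal to $\{x_j-x_i=-s\}$). A braid-type arrangement is a finite set of such hyperplanes. For $S\subseteq\mathbb{Z}$, $\mathcal{A}_S^n=\{\{x_i-x_j=s\}:1\le i<j\le n,\ s\in S\}$, and $-S=\{ -s:s\in S\}$. An arrangement $\mathcal{A}$ is symmetric if $\pi(\mathcal{A})=\mathcal{A}$ for every permutation $\pi$ of $[n]$, acting on $\mathbb{R}^n$ by $\pi\cdot(x_1,\dots,x_n)=(x_{\pi^{ -1}(1)},\dots,x_{\pi^{ -1}(n)})$. $\mathcal{A}$ is strongly transitive if for all distinct $i,j,k\in[n]$ and integers $s,t\ge0$: if $\{x_i-x_j=s\}\notin\mathcal{A}$ and $\{x_j-x_k=t\}\notin\mathcal{A}$ then $\{x_i-x_k=s+t\}\notin\mathcal{A}$. -}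

module Defs where

open import Level using (0ℓ)
open import Data.Nat using (ℕ)
open import Data.Integer using (ℤ; +_; -_)
open import Data.Fin using (Fin; _<_)
open import Data.Fin.Permutation using (Permutation′; _⟨$⟩ʳ_)
open import Data.Product using (Σ; ∃; _×_; _,_)
open import Data.Sum using (_⊎_)
open import Data.List using (List)
open import Data.List.Relation.Unary.All using (All)
open import Data.List.Relation.Unary.Any using (Any)
open import Relation.Binary.PropositionalEquality using (_≡_; _≢_)
open import Relation.Nullary using (¬_)
open import Function.Bundles using (_⇔_)

-- A hyperplane {x_i - x_j = s} (i ≠ j) is encoded by the triple (i , j , s).
-- Two triples denote the same hyperplane iff they coincide or one is the
-- "reversal" (j , i , -s) of the other.
SameHyp : ∀ {n} → Fin n → Fin n → ℤ → Fin n → Fin n → ℤ → Set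
SameHyp k l t i j s = (k ≡ i × l ≡ j × t ≡ s) ⊎ (k ≡ j × l ≡ i × t ≡ - s)

Triple : ℕ → Set
Triple n = Σ (Fin n) λ _ → Σ (Fin n) λ _ → ℤ

-- A braid-type arrangement in ℝ^n: a finite list of hyperplanes {x_i - x_j = s}
-- with i ≠ j (repetitions in the list are harmless: only membership matters).
record BraidArr (n : ℕ) : Set where
  constructor mkArr
  field
    hyps    : List (Triple n)
    distinct : All (λ { (i , j , _) → i ≢ j }) hyps
open BraidArr public

Mem : ∀ {n} → BraidArr n → Fin n → Fin n → ℤ → Set
Mem A i j s = Any (λ { (k , l , t) → SameHyp k l t i j s }) (hyps A)

InAS : ∀ {n} → (ℤ → Set) → Fin n → Fin n → ℤ → Set
InAS {n} S i j s = ∃ λ (k : Fin n) → ∃ λ (l : Fin n) → ∃ λ (t : ℤ) →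
  k < l × S t × SameHyp k l t i j s

IsAS : ∀ {n} → BraidArr n → (ℤ → Set) → Set
IsAS {n} A S = (i j : Fin n) → i ≢ j → (s : ℤ) → ((Mem A i j s) ⇔ InAS S i j s)

Symmetric : ∀ {n} → BraidArr n → Set
Symmetric {n} A = (π : Permutation′ n) → (i j : Fin n) → i ≢ j → (s : ℤ) →
  ((Mem A (π ⟨$⟩ʳ i) (π ⟨$⟩ʳ j) s) ⇔ (Mem A i j s))

StronglyTransitive : ∀ {n} → BraidArr n → Set
StronglyTransitive {n} A = (i j k : Fin n) → i ≢ j → j ≢ k → i ≢ k → (s t : ℕ) →
  ¬ (Mem A i j (+ s)) → ¬ (Mem A j k (+ t)) → ¬ (Mem A i k (+ (s Data.Nat.+ t)))

SymmetricSet : (ℤ → Set) → Set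
SymmetricSet S = (s : ℤ) → (S s ⇔ S (- s))

GapClosed : (ℤ → Set) → Set
GapClosed S = (s t : ℕ) → ¬ S (+ s) → ¬ S (+ t) → ¬ S (+ (s Data.Nat.+ t))

{-# OPTIONS --safe #-}
module Submission where

-- Each side of the equivalence makes membership of {x_i - x_j = s} in A independent of the
-- pair (i , j): a symmetric arrangement can move any pair of distinct coordinates to any other
-- by two transpositions, while A_S^n with S = -S contains {x_i - x_j = s} exactly when s ∈ S.
-- Once A is described by a single offset set S in this way, strong transitivity of A is
-- literally the condition on S, read off on three distinct coordinates (hence n ≥ 3).

open import Defs
open import Data.Nat using (ℕ; _≤_; s≤s)
open import Data.Integer using (ℤ; -_)
open import Data.Integer.Properties using (neg-involutive)
open import Data.Product using (∃; _×_; _,_)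
open import Data.Sum using (inj₁; inj₂)
open import Data.Fin using (Fin)
open import Data.Fin.Patterns using (0F; 1F; 2F)
open import Data.Fin.Properties using (<-cmp; _≟_)
open import Data.Fin.Permutation using (Permutation′; _⟨$⟩ʳ_; transpose)
open import Data.List.Relation.Unary.Any as Any using ()
open import Function.Base using (_∘_)
open import Function.Bundles using (_⇔_; mk⇔; Equivalence; Injection)
open import Function.Construct.Composition using (_⇔-∘_)
open import Function.Construct.Symmetry using (⇔-sym)
open import Function.Properties.Inverse using (↔⇒↣)
open import Relation.Binary.Definitions using (tri<; tri≈; tri>)
open import Relation.Binary.PropositionalEquality using (_≡_; _≢_; refl; sym; subst; subst₂)
open import Relation.Nullary.Decidable using (dec-true; dec-false)
open import Relation.Nullary.Negation using (contradiction)

open Equivalence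

private
  variable
    n : ℕ
    i j k : Fin n
    s : ℤ
    S : ℤ → Set

permute-≢ : (π : Permutation′ n) → i ≢ j → π ⟨$⟩ʳ i ≢ π ⟨$⟩ʳ j
permute-≢ π i≢j = i≢j ∘ Injection.injective (↔⇒↣ π)

transpose-matchˡ : (i j : Fin n) → transpose i j ⟨$⟩ʳ i ≡ j
transpose-matchˡ i j rewrite dec-true (i ≟ i) refl = refl

transpose-other : (i j : Fin n) → k ≢ i → k ≢ j → transpose i j ⟨$⟩ʳ k ≡ k
transpose-other {k = k} i j k≢i k≢j rewrite dec-false (k ≟ i) k≢i | dec-false (k ≟ j) k≢j = refl

SameHyp-reverse : {k l : Fin n} {t : ℤ} → SameHyp k l t i j s → SameHyp k l t j i (- s)
SameHyp-reverse {s = s} (inj₁ (k≡i , l≡j , t≡s)) =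
  inj₂ (k≡i , l≡j , subst (_ ≡_) (sym (neg-involutive s)) t≡s)
SameHyp-reverse (inj₂ (k≡j , l≡i , t≡-s)) = inj₁ (k≡j , l≡i , t≡-s)

Mem-reverse : (A : BraidArr n) → Mem A i j s ⇔ Mem A j i (- s)
Mem-reverse {i = i} {j} {s} A = mk⇔ reverse (subst (Mem A i j) (neg-involutive s) ∘ reverse)
  where
  reverse : ∀ {i j s} → Mem A i j s → Mem A j i (- s)
  reverse = Any.map SameHyp-reverse

InAS⇔ : SymmetricSet S → i ≢ j → InAS S i j s ⇔ S s
InAS⇔ {S = S} {i = i} {j = j} {s = s} symS i≢j = mk⇔ offset oriented
  where
  offset : InAS S i j s → S s
  offset (_ , _ , _ , _ , St , inj₁ (refl , refl , refl)) = St
  offset (_ , _ , _ , _ , St , inj₂ (refl , refl , refl)) = from (symS s) St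

  oriented : S s → InAS S i j s
  oriented Ss with <-cmp i j
  ... | tri< i<j _ _ = i , j , s , i<j , Ss , inj₁ (refl , refl , refl)
  ... | tri≈ _ i≡j _ = contradiction i≡j i≢j
  ... | tri> _ _ j<i = j , i , - s , j<i , to (symS s) Ss , inj₂ (refl , refl , refl)

Uniform : BraidArr n → (ℤ → Set) → Set
Uniform {n} A S = ∀ {i j : Fin n} → i ≢ j → ∀ s → Mem A i j s ⇔ S s

IsAS⇔Uniform : (A : BraidArr n) → SymmetricSet S → IsAS A S ⇔ Uniform A S
IsAS⇔Uniform A symS =
  mk⇔ (λ isAS {i} {j} i≢j s → InAS⇔ symS i≢j ⇔-∘ isAS i j i≢j s)
      (λ uniform i j i≢j s → ⇔-sym (InAS⇔ symS i≢j) ⇔-∘ uniform i≢j s)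

module _ (A : BraidArr n) (symA : Symmetric A) where

  Mem-permute : (π : Permutation′ n) {i j : Fin n} →
                i ≢ j → Mem A i j s → Mem A (π ⟨$⟩ʳ i) (π ⟨$⟩ʳ j) s
  Mem-permute π i≢j = from (symA π _ _ i≢j _)

  -- Move a to i by one transposition, then the image of b to j by one fixing i.
  Mem-transfer : {a b i j : Fin n} {s : ℤ} → a ≢ b → i ≢ j → Mem A a b s → Mem A i j s
  Mem-transfer {a} {b} {i} {j} {s} a≢b i≢j =
    subst₂ (λ x y → Mem A x y s) (transpose-other c j i≢c i≢j) (transpose-matchˡ c j)
    ∘ Mem-permute (transpose c j) i≢c
    ∘ subst (λ x → Mem A x c s) (transpose-matchˡ a i)
    ∘ Mem-permute σ a≢b
    where
    σ = transpose a i
    c = σ ⟨$⟩ʳ b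
    i≢c : i ≢ c
    i≢c = subst (_≢ c) (transpose-matchˡ a i) (permute-≢ σ a≢b)

  Symmetric⇒Uniform : {a b : Fin n} → a ≢ b → Uniform A (Mem A a b)
  Symmetric⇒Uniform a≢b i≢j s = mk⇔ (Mem-transfer i≢j a≢b) (Mem-transfer a≢b i≢j)

Uniform⇒Symmetric : (A : BraidArr n) → Uniform A S → Symmetric A
Uniform⇒Symmetric A uniform π i j i≢j s =
  ⇔-sym (uniform i≢j s) ⇔-∘ uniform (permute-≢ π i≢j) s

Uniform⇒SymmetricSet : (A : BraidArr n) → Uniform A S → {a b : Fin n} → a ≢ b → SymmetricSet S
Uniform⇒SymmetricSet A uniform a≢b s =
  uniform (a≢b ∘ sym) (- s) ⇔-∘ (Mem-reverse A ⇔-∘ ⇔-sym (uniform a≢b s))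

Uniform⇒StronglyTransitive⇔GapClosed : (A : BraidArr n) → Uniform A S → {i j k : Fin n} →
  i ≢ j → j ≢ k → i ≢ k → StronglyTransitive A ⇔ GapClosed S
Uniform⇒StronglyTransitive⇔GapClosed A uniform i≢j j≢k i≢k = mk⇔
  (λ st s t s∉S t∉S s+t∈S → st _ _ _ i≢j j≢k i≢k s t
    (s∉S ∘ to (uniform i≢j _)) (t∉S ∘ to (uniform j≢k _)) (from (uniform i≢k _) s+t∈S))
  (λ gap _ _ _ i≢j j≢k i≢k s t s∉A t∉A s+t∈A → gap s t
    (s∉A ∘ from (uniform i≢j _)) (t∉A ∘ from (uniform j≢k _)) (to (uniform i≢k _) s+t∈A))

lemma5p1 : (n : ℕ) → 3 ≤ n → (A : BraidArr n) →
    ((Symmetric A × StronglyTransitive A) ⇔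
     (∃ λ (S : ℤ → Set) → SymmetricSet S × GapClosed S × IsAS A S))
lemma5p1 _ (s≤s (s≤s (s≤s _))) A = mk⇔ offsets arrangement
  where
  strong⇔gap : ∀ {S} → Uniform A S → StronglyTransitive A ⇔ GapClosed S
  strong⇔gap uniform =
    Uniform⇒StronglyTransitive⇔GapClosed A uniform {0F} {1F} {2F} (λ ()) (λ ()) (λ ())

  offsets : Symmetric A × StronglyTransitive A → ∃ λ S → SymmetricSet S × GapClosed S × IsAS A S
  offsets (symA , st) =
    Mem A 0F 1F , symS , to (strong⇔gap uniform) st , from (IsAS⇔Uniform A symS) uniform
    where
    uniform : Uniform A (Mem A 0F 1F)
    uniform = Symmetric⇒Uniform A symA (λ ())
    symS : SymmetricSet (Mem A 0F 1F)
    symS = Uniform⇒SymmetricSet A uniform {0F} {1F} (λ ())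

  arrangement : (∃ λ S → SymmetricSet S × GapClosed S × IsAS A S) → Symmetric A × StronglyTransitive A
  arrangement (S , symS , gap , isAS) = Uniform⇒Symmetric A uniform , from (strong⇔gap uniform) gap
    where
    uniform : Uniform A S
    uniform = to (IsAS⇔Uniform A symS) isAS
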